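{- For every integer $n\ge1$, there is a bijection between $\mathcal{U}_n^K$ and $\mathcal{U}_{n-1}^K\cup\mathcal{U}_{n-1}^S\cup\mathcal{B}_{n-1}^{KS}$, and $|\mathcal{U}_n|=|\mathcal{T}_{\le n-1}|$.
   Context: Graphs are finite and simple; $\omega,\alpha$ are clique and independence numbers. A KS-partition of $G$ is a partition $V(G)=K\cup S$ with $K$ a clique and $S$ a stable set; a split graph is one having a KS-partition; the KS-partition is $K$-max if $|K|=\omega(G)$ and $S$-max if $|S|=\alpha(G)$. A split graph is balanced if it has a KS-partition that is both $K$-max and $S$-max (such a partition is then unique), unbalanced otherwise. $\mathcal{U}_n$ is the set of unlabeled unbalanced split graphs on $n$ vertices. $\mathcal{U}_n^K$ (resp. $\mathcal{U}_n^S$) is the set of triples $(G,K_G,S_G)$ with $G$ an unlabeled unbalanced split graph on $n$ vertices and $K_G\cup S_G$ a $K$-max (resp. $S$-max) KS-partition of $G$, triples being identified up to isomorphism. $\mathcal{B}_n^{KS}$ is the set of triples $(G,K_G,S_G)$ with $G$ an unlabeled balanced split graph on $n$ vertices and $K_G\cup S_G$ its unique KS-partition (with $\mathcal{B}_0^{KS}$ consisting of the null graph). $\mathcal{T}_{\le k}$ is the set of unlabeled split graphs on at most $k$ vertices, including the graph on $0$ vertices. -}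

module Defs where

open import Data.Nat using (ℕ; zero; suc; _≤_)
open import Data.Bool using (Bool; true; false)
open import Data.Fin using (Fin)
open import Data.Fin.Subset using (Subset; _∈_; ∁; ∣_∣)
open import Data.Fin.Permutation using (Permutation; _⟨$⟩ʳ_)
open import Data.Vec using (lookup)
open import Data.Product using (Σ; ∃; _×_; _,_)
open import Data.Sum using (_⊎_; inj₁; inj₂)
open import Data.Empty using (⊥)
open import Relation.Nullary using (¬_)
open import Relation.Binary.PropositionalEquality using (_≡_; _≢_)

record Graph (n : ℕ) : Set where
  field
    adj    : Fin n → Fin n → Bool
    sym    : ∀ i j → adj i j ≡ adj j i
    irrefl : ∀ i → adj i i ≡ false
open Graph public

Edge : ∀ {n} → Graph n → Fin n → Fin n → Set
Edge G i j = adj G i j ≡ true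

IsClique : ∀ {n} → Graph n → Subset n → Set
IsClique G C = ∀ i j → i ∈ C → j ∈ C → i ≢ j → Edge G i j

IsStable : ∀ {n} → Graph n → Subset n → Set
IsStable G T = ∀ i j → i ∈ T → j ∈ T → ¬ Edge G i j

-- A KS-partition V = K ∪ S is encoded by K; S is its complement ∁ K.
IsKS : ∀ {n} → Graph n → Subset n → Set
IsKS G K = IsClique G K × IsStable G (∁ K)

IsSplit : ∀ {n} → Graph n → Set
IsSplit G = ∃ λ K → IsKS G K

KMax : ∀ {n} → Graph n → Subset n → Set
KMax G K = ∀ C → IsClique G C → ∣ C ∣ ≤ ∣ K ∣

SMax : ∀ {n} → Graph n → Subset n → Set
SMax G K = ∀ T → IsStable G T → ∣ T ∣ ≤ ∣ ∁ K ∣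

Balanced : ∀ {n} → Graph n → Set
Balanced G = ∃ λ K → IsKS G K × KMax G K × SMax G K

Unbalanced : ∀ {n} → Graph n → Set
Unbalanced G = IsSplit G × ¬ Balanced G

-- Isomorphisms (a bijection Fin m ↔ Fin n; only exists when m ≡ n).

GraphIso : ∀ {m n} → Graph m → Graph n → Set
GraphIso {m} {n} G H = Σ (Permutation m n) λ π →
  ∀ i j → adj H (π ⟨$⟩ʳ i) (π ⟨$⟩ʳ j) ≡ adj G i j

TripleIso : ∀ {m n} → Graph m → Subset m → Graph n → Subset n → Set
TripleIso {m} {n} G K H K' = Σ (Permutation m n) λ π →
  (∀ i j → adj H (π ⟨$⟩ʳ i) (π ⟨$⟩ʳ j) ≡ adj G i j) ×
  (∀ i → lookup K' (π ⟨$⟩ʳ i) ≡ lookup K i)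

-- The families (as labelled representatives; "unlabelled" = up to the
-- corresponding isomorphism relation).

U : ℕ → Set
U n = Σ (Graph n) Unbalanced

U≈ : ∀ {n} → U n → U n → Set
U≈ (G , _) (H , _) = GraphIso G H

UK : ℕ → Set
UK n = Σ (Graph n) λ G → Σ (Subset n) λ K → Unbalanced G × IsKS G K × KMax G K

US : ℕ → Set
US n = Σ (Graph n) λ G → Σ (Subset n) λ K → Unbalanced G × IsKS G K × SMax G K

BKS : ℕ → Set
BKS n = Σ (Graph n) λ G → Σ (Subset n) λ K → IsKS G K × KMax G K × SMax G K

UK≈ : ∀ {n} → UK n → UK n → Set
UK≈ (G , K , _) (H , K' , _) = TripleIso G K H K'

US≈ : ∀ {n} → US n → US n → Set
US≈ (G , K , _) (H , K' , _) = TripleIso G K H K'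

BKS≈ : ∀ {n} → BKS n → BKS n → Set
BKS≈ (G , K , _) (H , K' , _) = TripleIso G K H K'

-- U_n^K ∪ U_n^S ∪ B_n^KS : these three sets of triples are pairwise
-- disjoint, so their union is the disjoint union.
Union : ℕ → Set
Union n = UK n ⊎ (US n ⊎ BKS n)

Union≈ : ∀ {n} → Union n → Union n → Set
Union≈ (inj₁ a) (inj₁ b) = UK≈ a b
Union≈ (inj₂ (inj₁ a)) (inj₂ (inj₁ b)) = US≈ a b
Union≈ (inj₂ (inj₂ a)) (inj₂ (inj₂ b)) = BKS≈ a b
Union≈ _ _ = ⊥

-- T_{≤k}: split graphs on at most k vertices (including the null graph)
T≤ : ℕ → Set
T≤ k = Σ ℕ λ m → m ≤ k × Σ (Graph m) IsSplit

T≈ : ∀ {k} → T≤ k → T≤ k → Set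
T≈ (_ , _ , G , _) (_ , _ , H , _) = GraphIso G H

-- f : A → B induces a bijection A/≈ → B/≈′ between the sets of
-- equivalence classes: it respects and reflects the equivalences and
-- is surjective up to ≈′.
InducesBijection : {A B : Set} → (A → A → Set) → (B → B → Set) → (A → B) → Set
InducesBijection {A} {B} _≈_ _≈′_ f =
  (∀ a a′ → a ≈ a′ → f a ≈′ f a′) ×
  (∀ a a′ → f a ≈′ f a′ → a ≈ a′) ×
  (∀ b → ∃ λ a → f a ≈′ b)

QuotBij : {A B : Set} → (A → A → Set) → (B → B → Set) → Set
QuotBij {A} {B} _≈_ _≈′_ = Σ (A → B) (InducesBijection _≈_ _≈′_)

-- * Hammer–Simeone: a KS-partition (K,S) is K-max iff no vertex of S is
--   adjacent to all of K (K cannot grow), and S-max iff no vertex of K is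
--   non-adjacent to all of S (S cannot grow).  At most one of the two
--   growths is possible, so every KS-triple is exactly one of: K-max only
--   (in U^K), S-max only (in U^S), or both (in B^KS).  Hence KS-triples on
--   m vertices, up to isomorphism, are in bijection with U_m^K ∪ U_m^S ∪ B_m^KS.
-- * In a K-max partition of an unbalanced graph S can grow, i.e. some
--   z ∈ K has no neighbour in S; z is then adjacent exactly to K ∖ {z}, so any
--   two such vertices are twins.  Deleting z is therefore well defined up to
--   isomorphism and is inverted by attaching a new vertex adjacent exactly
--   to K: this is the first bijection U_{m+1}^K ≅ KS-triples on m vertices.
-- * K-max and S-max partitions are unique up to isomorphism (two distinct
--   KS-partitions differ by swapping two twins), so U^K ≅ U ≅ U^S, and split
--   graphs on m vertices are U_m ⊎ B_m^KS.  Hence U_{m+1} ≅ U_m ⊎ Split_m, and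
--   induction on m gives U_{m+1} ≅ T_{≤ m}.
module Submission where

open import Defs hiding (sym)
open import Level using (0ℓ)
open import Function using (_∘_)
open import Data.Nat using (ℕ; zero; suc; _≤_; _∸_; z≤n; s≤s)
open import Data.Nat.Properties using (≤-refl; ≤-antisym; <-irrefl; m≤n⇒m≤1+n; m∸[m∸n]≡n; _≤?_; ≰⇒>; module ≤-Reasoning)
open import Data.Bool using (Bool; true; false; not)
open import Data.Bool.Properties using (¬-not; not-¬) renaming (_≟_ to _≟ᵇ_)
open import Data.Fin using (Fin; zero; suc; punchIn; punchOut) renaming (_≟_ to _≟ᶠ_)
open import Data.Fin.Properties using (any?; all?; ¬∀⟶∃¬; punchIn-injective; punchInᵢ≢i; punchIn-punchOut)
open import Data.Fin.Subset using (Subset; _∈_; ∁; ∣_∣)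
open import Data.Fin.Subset.Properties using (∣∁p∣≡n∸∣p∣; ∣p∣≤n; p⊆q⇒∣p∣≤∣q∣)
open import Data.Fin.Permutation using (Permutation; _⟨$⟩ʳ_; _⟨$⟩ˡ_; inverseʳ; inverseˡ; _∘ₚ_; flip; insert; remove; insert-punchIn; punchIn-permute; ↔⇒≡) renaming (id to idₚ; transpose to transposeₚ)
import Data.Fin.Permutation.Components as PC
open import Data.Vec using ([]; _∷_; lookup; tabulate; _[_]≔_)
open import Data.Vec.Properties using (map-[]≔; lookup∘tabulate; lookup-map; []=⇒lookup; lookup⇒[]=; lookup∘update; lookup∘update′)
open import Data.Product using (Σ; ∃; _×_; _,_; proj₁; proj₂)
open import Data.Sum using (_⊎_; inj₁; inj₂)
open import Data.Sum.Relation.Binary.Pointwise using (Pointwise; inj₁; inj₂; ⊎-isEquivalence)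
open import Data.Empty using (⊥; ⊥-elim)
open import Relation.Nullary using (¬_; Dec; yes; no)
open import Relation.Nullary.Decidable using (_×-dec_; _→-dec_)
open import Relation.Binary using (Rel; IsEquivalence)
import Relation.Binary.Construct.On as On
open import Relation.Binary.PropositionalEquality using (_≡_; _≢_; refl; sym; trans; cong; subst; subst₂; module ≡-Reasoning)

module _ {A B C : Set} {R : Rel A 0ℓ} {S : Rel B 0ℓ} {T : Rel C 0ℓ} where

  qb-comp : IsEquivalence T → QuotBij R S → QuotBij S T → QuotBij R T
  qb-comp eqT (f , f-resp , f-refl , f-surj) (g , g-resp , g-refl , g-surj) =
    g ∘ f , (λ a a′ → g-resp _ _ ∘ f-resp a a′) , (λ a a′ → f-refl a a′ ∘ g-refl _ _) , surj
    where
    surj : ∀ c → ∃ λ a → T (g (f a)) c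
    surj c with g-surj c
    ... | b , gb≈c with f-surj b
    ...   | a , fa≈b = a , IsEquivalence.trans eqT (g-resp _ _ fa≈b) gb≈c

module _ {A B : Set} {R : Rel A 0ℓ} {S : Rel B 0ℓ} where

  qb-inv : IsEquivalence S → QuotBij R S → QuotBij S R
  qb-inv eqS (f , f-resp , f-refl , f-surj) = section , resp , refl′ , surj
    where
    open IsEquivalence eqS renaming (sym to symS; trans to transS)
    section : B → A
    section b = proj₁ (f-surj b)
    onSection : ∀ b → S (f (section b)) b
    onSection b = proj₂ (f-surj b)
    resp : ∀ b b′ → S b b′ → R (section b) (section b′)
    resp b b′ e = f-refl _ _ (transS (onSection b) (transS e (symS (onSection b′))))
    refl′ : ∀ b b′ → R (section b) (section b′) → S b b′
    refl′ b b′ e = transS (symS (onSection b)) (transS (f-resp _ _ e) (onSection b′))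
    surj : ∀ a → ∃ λ b → R (section b) a
    surj a = f a , f-refl _ _ (onSection (f a))

  qb-drop-empty : IsEquivalence S → ¬ A → QuotBij (Pointwise R S) S
  qb-drop-empty eqS ¬a = f , resp , refl′ , λ b → inj₂ b , IsEquivalence.refl eqS
    where
    f : A ⊎ B → B
    f (inj₁ a) = ⊥-elim (¬a a)
    f (inj₂ b) = b
    resp : ∀ x y → Pointwise R S x y → S (f x) (f y)
    resp _ _ (inj₁ {a} _) = ⊥-elim (¬a a)
    resp _ _ (inj₂ e) = e
    refl′ : ∀ x y → S (f x) (f y) → Pointwise R S x y
    refl′ (inj₁ a) _ _ = ⊥-elim (¬a a)
    refl′ _ (inj₁ a) _ = ⊥-elim (¬a a)
    refl′ (inj₂ _) (inj₂ _) e = inj₂ e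

module _ {A : Set} {R S : Rel A 0ℓ} where

  qb-relabel : IsEquivalence S → (∀ x y → R x y → S x y) → (∀ x y → S x y → R x y) → QuotBij R S
  qb-relabel eqS R⇒S S⇒R = (λ x → x) , R⇒S , S⇒R , λ b → b , IsEquivalence.refl eqS

qb-id : ∀ {A : Set} {R : Rel A 0ℓ} → IsEquivalence R → QuotBij R R
qb-id eqR = qb-relabel eqR (λ _ _ e → e) (λ _ _ e → e)

module _ {A A′ B B′ : Set} {R : Rel A 0ℓ} {R′ : Rel A′ 0ℓ} {S : Rel B 0ℓ} {S′ : Rel B′ 0ℓ} where

  qb-sum : QuotBij R R′ → QuotBij S S′ → QuotBij (Pointwise R S) (Pointwise R′ S′)
  qb-sum (f , f-resp , f-refl , f-surj) (g , g-resp , g-refl , g-surj) = h , resp , refl′ , surj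
    where
    h : A ⊎ B → A′ ⊎ B′
    h (inj₁ a) = inj₁ (f a)
    h (inj₂ b) = inj₂ (g b)
    resp : ∀ x y → Pointwise R S x y → Pointwise R′ S′ (h x) (h y)
    resp _ _ (inj₁ e) = inj₁ (f-resp _ _ e)
    resp _ _ (inj₂ e) = inj₂ (g-resp _ _ e)
    refl′ : ∀ x y → Pointwise R′ S′ (h x) (h y) → Pointwise R S x y
    refl′ (inj₁ a) (inj₁ a′) (inj₁ e) = inj₁ (f-refl a a′ e)
    refl′ (inj₂ b) (inj₂ b′) (inj₂ e) = inj₂ (g-refl b b′ e)
    surj : ∀ y → ∃ λ x → Pointwise R′ S′ (h x) y
    surj (inj₁ a′) = inj₁ (proj₁ (f-surj a′)) , inj₁ (proj₂ (f-surj a′))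
    surj (inj₂ b′) = inj₂ (proj₁ (g-surj b′)) , inj₂ (proj₂ (g-surj b′))

In : ∀ {n} → Subset n → Fin n → Set
In K i = lookup K i ≡ true

Out : ∀ {n} → Subset n → Fin n → Set
Out K i = lookup K i ≡ false

-- In K i is not injective in K, so K is an explicit argument below.

∈⇒In : ∀ {n} {K : Subset n} {i} → i ∈ K → In K i
∈⇒In = []=⇒lookup

In-Out : ∀ {b : Bool} → b ≡ true → b ≡ false → ⊥
In-Out = not-¬

module _ {n : ℕ} (K : Subset n) {i : Fin n} where

  In⇒∈ : In K i → i ∈ K
  In⇒∈ = lookup⇒[]= i K

  Out⇒In∁ : Out K i → In (∁ K) i
  Out⇒In∁ o = trans (lookup-map i not K) (cong not o)

  Out⇒∈∁ : Out K i → i ∈ ∁ K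
  Out⇒∈∁ o = lookup⇒[]= i (∁ K) (Out⇒In∁ o)

  ∈∁⇒Out : i ∈ ∁ K → Out K i
  ∈∁⇒Out i∈∁K = ¬-not λ k → not-¬ ([]=⇒lookup i∈∁K) (trans (lookup-map i not K) (cong not k))

In-or-Out : ∀ {n} (K : Subset n) i → In K i ⊎ Out K i
In-or-Out K i with lookup K i
... | true = inj₁ refl
... | false = inj₂ refl

In? : ∀ {n} (K : Subset n) i → Dec (In K i)
In? K i = lookup K i ≟ᵇ true

Out? : ∀ {n} (K : Subset n) i → Dec (Out K i)
Out? K i = lookup K i ≟ᵇ false

In≢Out : ∀ {n} (K : Subset n) {i j} → In K i → Out K j → i ≢ j
In≢Out K ki kj refl = In-Out ki kj

_⊆ᵇ_ : ∀ {n} → Subset n → Subset n → Set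
K ⊆ᵇ K′ = ∀ i → In K i → In K′ i

counterexample : ∀ {n} {A B : Fin n → Set} → (∀ i → Dec (A i)) → (∀ i → Dec (B i)) →
  ¬ (∀ i → A i → B i) → ∃ λ i → A i × ¬ B i
counterexample {n} A? B? ¬∀ with ¬∀⟶∃¬ n _ (λ i → A? i →-dec B? i) ¬∀
... | i , ¬A⇒B with A? i
...   | yes a = i , a , λ b → ¬A⇒B (λ _ → b)
...   | no ¬a = ⊥-elim (¬A⇒B (λ a → ⊥-elim (¬a a)))

update-other : ∀ {n} (K : Subset n) s b {i} → i ≢ s → lookup (K [ s ]≔ b) i ≡ lookup K i
update-other K s b i≢s = lookup∘update′ i≢s K b

update-opposite : ∀ {n} (K : Subset n) s b {i} → lookup (K [ s ]≔ b) i ≡ not b → i ≢ s × lookup K i ≡ not b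
update-opposite K s b {i} e with i ≟ᶠ s
... | yes refl = ⊥-elim (not-¬ (lookup∘update s K b) e)
... | no i≢s = i≢s , trans (sym (update-other K s b i≢s)) e

card-mono : ∀ {n} (p q : Subset n) → p ⊆ᵇ q → ∣ p ∣ ≤ ∣ q ∣
card-mono p q p⊆q = p⊆q⇒∣p∣≤∣q∣ {p = p} {q = q} (λ {i} i∈p → In⇒∈ q (p⊆q i (∈⇒In i∈p)))

card-insert : ∀ {n} (p : Subset n) i → Out p i → ∣ p [ i ]≔ true ∣ ≡ suc ∣ p ∣
card-insert (false ∷ p) zero _ = refl
card-insert (true ∷ p) (suc i) o = cong suc (card-insert p i o)
card-insert (false ∷ p) (suc i) o = card-insert p i o

card-remove : ∀ {n} (p : Subset n) i → In p i → ∣ p ∣ ≡ suc ∣ p [ i ]≔ false ∣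
card-remove (true ∷ p) zero _ = refl
card-remove (true ∷ p) (suc i) k = cong suc (card-remove p i k)
card-remove (false ∷ p) (suc i) k = card-remove p i k

card-move : ∀ {n} (K : Subset n) z → In K z → ∣ ∁ (K [ z ]≔ false) ∣ ≡ suc ∣ ∁ K ∣
card-move K z z∈K = trans (cong ∣_∣ (map-[]≔ not K z))
  (card-insert (∁ K) z (trans (lookup-map z not K) (cong not z∈K)))

-- Exchange bound: if p ∖ {a} ⊆ q for some a ∈ p, and q has an element
-- b ∉ p, then |p| ≤ |q|  (p with a replaced by b is contained in q).
card-exchange : ∀ {n} (p q : Subset n) {a b} → In p a → Out p b → In q b →
  (∀ i → i ≢ a → In p i → In q i) → ∣ p ∣ ≤ ∣ q ∣
card-exchange p q {a} {b} pa pb qb p∖a⊆q = begin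
    ∣ p ∣              ≡⟨ card-remove p a pa ⟩
    suc ∣ p′ ∣         ≡⟨ sym (card-insert p′ b p′b) ⟩
    ∣ p′ [ b ]≔ true ∣ ≤⟨ card-mono (p′ [ b ]≔ true) q p″⊆q ⟩
    ∣ q ∣              ∎
  where
  open ≤-Reasoning
  p′ : Subset _
  p′ = p [ a ]≔ false
  p′b : Out p′ b
  p′b with b ≟ᶠ a
  ... | yes refl = lookup∘update a p false
  ... | no b≢a = trans (update-other p a false b≢a) pb
  p″⊆q : (p′ [ b ]≔ true) ⊆ᵇ q
  p″⊆q i hi with i ≟ᶠ b | i ≟ᶠ a
  ... | yes refl | _ = qb
  ... | no i≢b | yes refl = ⊥-elim (In-Out hi (trans (update-other p′ b true i≢b) (lookup∘update i p false)))
  ... | no i≢b | no i≢a =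
    p∖a⊆q i i≢a (trans (sym (trans (update-other p′ b true i≢b) (update-other p a false i≢a))) hi)

-- Graphs and KS-partitions.  Below, a KS-partition is given by K (and
-- S = ∁ K); the graph is an explicit argument so that K can be inferred.

adj-cong : ∀ {n} (G : Graph n) {i i′ j j′} → i ≡ i′ → j ≡ j′ → adj G i j ≡ adj G i′ j′
adj-cong G refl refl = refl

Edge-sym : ∀ {n} (G : Graph n) {i j} → Edge G i j → Edge G j i
Edge-sym G {i} {j} e = trans (Graph.sym G j i) e

mkKS : ∀ {n} (G : Graph n) K → (∀ i j → In K i → In K j → i ≢ j → Edge G i j) →
  (∀ i j → Out K i → Out K j → adj G i j ≡ false) → IsKS G K
mkKS G K clique stable =
  (λ i j i∈K j∈K → clique i j (∈⇒In i∈K) (∈⇒In j∈K)) ,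
  (λ i j i∈S j∈S e → In-Out e (stable i j (∈∁⇒Out K i∈S) (∈∁⇒Out K j∈S)))

module _ {n} (G : Graph n) {K : Subset n} (ks : IsKS G K) where

  K-edge : ∀ {i j} → In K i → In K j → i ≢ j → Edge G i j
  K-edge ki kj i≢j = proj₁ ks _ _ (In⇒∈ K ki) (In⇒∈ K kj) i≢j

  S-nonedge : ∀ {i j} → Out K i → Out K j → adj G i j ≡ false
  S-nonedge si sj = ¬-not (proj₂ ks _ _ (Out⇒∈∁ K si) (Out⇒∈∁ K sj))

Absorbable : ∀ {n} → Graph n → Subset n → Fin n → Set
Absorbable G K s = Out K s × (∀ k → In K k → Edge G s k)

Movable : ∀ {n} → Graph n → Subset n → Fin n → Set
Movable G K z = In K z × (∀ s → Out K s → adj G z s ≡ false)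

KGrowable : ∀ {n} → Graph n → Subset n → Set
KGrowable G K = ∃ (Absorbable G K)

SGrowable : ∀ {n} → Graph n → Subset n → Set
SGrowable G K = ∃ (Movable G K)

KGrowable? : ∀ {n} (G : Graph n) K → Dec (KGrowable G K)
KGrowable? G K = any? λ s → Out? K s ×-dec all? λ k → In? K k →-dec (adj G s k ≟ᵇ true)

SGrowable? : ∀ {n} (G : Graph n) K → Dec (SGrowable G K)
SGrowable? G K = any? λ z → In? K z ×-dec all? λ s → Out? K s →-dec (adj G z s ≟ᵇ false)

absorb : ∀ {n} → Subset n → Fin n → Subset n
absorb K s = K [ s ]≔ true

move : ∀ {n} → Subset n → Fin n → Subset n
move K z = K [ z ]≔ false

module _ {n} (G : Graph n) {K : Subset n} (ks : IsKS G K) where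

  absorb-KS : ∀ {s} → Absorbable G K s → IsKS G (absorb K s)
  absorb-KS {s} (_ , s-K) = mkKS G (absorb K s) clique stable
    where
    old : ∀ {i} → i ≢ s → In (absorb K s) i → In K i
    old i≢s k = trans (sym (update-other K s true i≢s)) k
    clique : ∀ i j → In (absorb K s) i → In (absorb K s) j → i ≢ j → Edge G i j
    clique i j ki kj i≢j with i ≟ᶠ s | j ≟ᶠ s
    ... | yes refl | yes refl = ⊥-elim (i≢j refl)
    ... | yes refl | no j≢s = s-K j (old j≢s kj)
    ... | no i≢s | yes refl = Edge-sym G (s-K i (old i≢s ki))
    ... | no i≢s | no j≢s = K-edge G ks (old i≢s ki) (old j≢s kj) i≢j
    stable : ∀ i j → Out (absorb K s) i → Out (absorb K s) j → adj G i j ≡ false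
    stable i j si sj = S-nonedge G ks (proj₂ (update-opposite K s true si)) (proj₂ (update-opposite K s true sj))

  -- After absorbing s no vertex can be absorbed: it would be adjacent to s ∈ S.
  absorb-¬KGrowable : ∀ {s} → Absorbable G K s → ¬ KGrowable G (absorb K s)
  absorb-¬KGrowable {s} (s∉K , _) (t , t∉K′ , t-K′) =
    In-Out (t-K′ s (lookup∘update s K true)) (S-nonedge G ks (proj₂ (update-opposite K s true t∉K′)) s∉K)

  move-KS : ∀ {z} → Movable G K z → IsKS G (move K z)
  move-KS {z} (_ , z-S) = mkKS G (move K z) clique stable
    where
    old : ∀ {i} → i ≢ z → Out (move K z) i → Out K i
    old i≢z s = trans (sym (update-other K z false i≢z)) s
    clique : ∀ i j → In (move K z) i → In (move K z) j → i ≢ j → Edge G i j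
    clique i j ki kj = K-edge G ks (proj₂ (update-opposite K z false ki)) (proj₂ (update-opposite K z false kj))
    stable : ∀ i j → Out (move K z) i → Out (move K z) j → adj G i j ≡ false
    stable i j si sj with i ≟ᶠ z | j ≟ᶠ z
    ... | yes refl | yes refl = Graph.irrefl G i
    ... | yes refl | no j≢z = z-S j (old j≢z sj)
    ... | no i≢z | yes refl = trans (Graph.sym G i z) (z-S i (old i≢z si))
    ... | no i≢z | no j≢z = S-nonedge G ks (old i≢z si) (old j≢z sj)

  -- After moving z no vertex can be moved: it would be adjacent to z ∈ S.
  move-¬SGrowable : ∀ {z} → Movable G K z → ¬ SGrowable G (move K z)
  move-¬SGrowable {z} (z∈K , _) (k , k∈K′ , k-S′) =
    In-Out (K-edge G ks k∈K z∈K k≢z) (k-S′ z (lookup∘update z K false))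
    where
    k≢z : k ≢ z
    k≢z = proj₁ (update-opposite K z false k∈K′)
    k∈K : In K k
    k∈K = proj₂ (update-opposite K z false k∈K′)

-- Hammer–Simeone characterisation of K-max and S-max partitions.

module _ {n} (G : Graph n) {K : Subset n} (ks : IsKS G K) where

  KMax⇒¬KGrowable : KMax G K → ¬ KGrowable G K
  KMax⇒¬KGrowable kmax (s , absorbable) =
    <-irrefl refl (subst (_≤ ∣ K ∣) (card-insert K s (proj₁ absorbable))
      (kmax (absorb K s) (proj₁ (absorb-KS G ks absorbable))))

  -- A clique C ⊈ K meets S in a single vertex s, which misses some k ∈ K ∖ C;
  -- so C is no larger than K (exchange s for k).
  ¬KGrowable⇒KMax : ¬ KGrowable G K → KMax G K
  ¬KGrowable⇒KMax ¬kg C C-clique with any? (λ s → In? C s ×-dec Out? K s)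
  ... | no C∩S=∅ = card-mono C K C⊆K
    where
    C⊆K : C ⊆ᵇ K
    C⊆K i ci with In-or-Out K i
    ... | inj₁ ki = ki
    ... | inj₂ si = ⊥-elim (C∩S=∅ (i , ci , si))
  ... | yes (s , cs , s∉K) with counterexample (In? K) (λ k → adj G s k ≟ᵇ true) (λ s-K → ¬kg (s , s∉K , s-K))
  ...   | k , k∈K , ¬sk = card-exchange C K cs k∉C k∈K C∖s⊆K
    where
    k∉C : Out C k
    k∉C = ¬-not λ ck → ¬sk (C-clique s k (In⇒∈ C cs) (In⇒∈ C ck) (λ s≡k → In≢Out K k∈K s∉K (sym s≡k)))
    C∖s⊆K : ∀ i → i ≢ s → In C i → In K i
    C∖s⊆K i i≢s ci with In-or-Out K i
    ... | inj₁ ki = ki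
    ... | inj₂ si = ⊥-elim (In-Out (C-clique i s (In⇒∈ C ci) (In⇒∈ C cs) i≢s) (S-nonedge G ks si s∉K))

  SMax⇒¬SGrowable : SMax G K → ¬ SGrowable G K
  SMax⇒¬SGrowable smax (z , movable) =
    <-irrefl refl (subst (_≤ ∣ ∁ K ∣) (card-move K z (proj₁ movable))
      (smax (∁ (move K z)) (proj₂ (move-KS G ks movable))))

  -- Dually, a stable set T ⊈ S meets K in a single vertex k, which has a
  -- neighbour s ∈ S ∖ T; so T is no larger than S (exchange k for s).
  ¬SGrowable⇒SMax : ¬ SGrowable G K → SMax G K
  ¬SGrowable⇒SMax ¬sg T T-stable with any? (λ k → In? T k ×-dec In? K k)
  ... | no T∩K=∅ = card-mono T (∁ K) T⊆S
    where
    T⊆S : T ⊆ᵇ ∁ K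
    T⊆S i ti with In-or-Out K i
    ... | inj₁ ki = ⊥-elim (T∩K=∅ (i , ti , ki))
    ... | inj₂ si = Out⇒In∁ K si
  ... | yes (k , tk , k∈K) with counterexample (Out? K) (λ s → adj G k s ≟ᵇ false) (λ k-S → ¬sg (k , k∈K , k-S))
  ...   | s , s∉K , ¬ks = card-exchange T (∁ K) tk s∉T (Out⇒In∁ K s∉K) T∖k⊆S
    where
    s∉T : Out T s
    s∉T = ¬-not λ ts → T-stable k s (In⇒∈ T tk) (In⇒∈ T ts) (¬-not ¬ks)
    T∖k⊆S : ∀ i → i ≢ k → In T i → In (∁ K) i
    T∖k⊆S i i≢k ti with In-or-Out K i
    ... | inj₁ ki = ⊥-elim (T-stable i k (In⇒∈ T ti) (In⇒∈ T tk) (K-edge G ks ki k∈K i≢k))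
    ... | inj₂ si = Out⇒In∁ K si

-- K and S cannot both grow: an absorbable s and a movable z would have to
-- be both adjacent and non-adjacent.
KGrowable⇒¬SGrowable : ∀ {n} (G : Graph n) K → KGrowable G K → ¬ SGrowable G K
KGrowable⇒¬SGrowable G K (s , s∉K , s-K) (z , z∈K , z-S) = In-Out (Edge-sym G (s-K z z∈K)) (z-S s s∉K)

kmax-partition : ∀ {n} (G : Graph n) → IsSplit G → Σ (Subset n) λ K → IsKS G K × ¬ KGrowable G K
kmax-partition G (K , ks) with KGrowable? G K
... | no ¬kg = K , ks , ¬kg
... | yes (s , a) = absorb K s , absorb-KS G ks a , absorb-¬KGrowable G ks a

smax-partition : ∀ {n} (G : Graph n) → IsSplit G → Σ (Subset n) λ K → IsKS G K × ¬ SGrowable G K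
smax-partition G (K , ks) with SGrowable? G K
... | no ¬sg = K , ks , ¬sg
... | yes (z , m) = move K z , move-KS G ks m , move-¬SGrowable G ks m

-- All K-max partitions have the same size, hence so do their S-sides:
-- in a balanced graph every K-max partition is S-max, and conversely.

∣K∣≡n∸∣∁K∣ : ∀ {n} (K : Subset n) → ∣ K ∣ ≡ n ∸ ∣ ∁ K ∣
∣K∣≡n∸∣∁K∣ {n} K = sym (trans (cong (n ∸_) (∣∁p∣≡n∸∣p∣ K)) (m∸[m∸n]≡n (∣p∣≤n K)))

module _ {n} (G : Graph n) {K : Subset n} (ks : IsKS G K) where

  balanced-KMax⇒SMax : Balanced G → KMax G K → SMax G K
  balanced-KMax⇒SMax (K₀ , ks₀ , kmax₀ , smax₀) kmax T T-stable = begin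
    ∣ T ∣         ≤⟨ smax₀ T T-stable ⟩
    ∣ ∁ K₀ ∣      ≡⟨ ∣∁p∣≡n∸∣p∣ K₀ ⟩
    n ∸ ∣ K₀ ∣    ≡⟨ cong (n ∸_) (≤-antisym (kmax K₀ (proj₁ ks₀)) (kmax₀ K (proj₁ ks))) ⟩
    n ∸ ∣ K ∣     ≡⟨ sym (∣∁p∣≡n∸∣p∣ K) ⟩
    ∣ ∁ K ∣       ∎
    where open ≤-Reasoning

  balanced-SMax⇒KMax : Balanced G → SMax G K → KMax G K
  balanced-SMax⇒KMax (K₀ , ks₀ , kmax₀ , smax₀) smax C C-clique = begin
    ∣ C ∣           ≤⟨ kmax₀ C C-clique ⟩
    ∣ K₀ ∣          ≡⟨ ∣K∣≡n∸∣∁K∣ K₀ ⟩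
    n ∸ ∣ ∁ K₀ ∣    ≡⟨ cong (n ∸_) (≤-antisym (smax (∁ K₀) (proj₂ ks₀)) (smax₀ (∁ K) (proj₂ ks))) ⟩
    n ∸ ∣ ∁ K ∣     ≡⟨ sym (∣K∣≡n∸∣∁K∣ K) ⟩
    ∣ K ∣           ∎
    where open ≤-Reasoning

  KMax∧¬SMax⇒Unbalanced : KMax G K → ¬ SMax G K → Unbalanced G
  KMax∧¬SMax⇒Unbalanced kmax ¬smax = (K , ks) , λ bal → ¬smax (balanced-KMax⇒SMax bal kmax)

  SMax∧¬KMax⇒Unbalanced : SMax G K → ¬ KMax G K → Unbalanced G
  SMax∧¬KMax⇒Unbalanced smax ¬kmax = (K , ks) , λ bal → ¬kmax (balanced-SMax⇒KMax bal smax)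

  Unbalanced∧KMax⇒SGrowable : Unbalanced G → KMax G K → SGrowable G K
  Unbalanced∧KMax⇒SGrowable (_ , ¬bal) kmax with SGrowable? G K
  ... | yes sg = sg
  ... | no ¬sg = ⊥-elim (¬bal (K , ks , kmax , ¬SGrowable⇒SMax G ks ¬sg))

giso-refl : ∀ {n} (G : Graph n) → GraphIso G G
giso-refl G = idₚ , λ _ _ → refl

giso-sym : ∀ {m n} (G : Graph m) (H : Graph n) → GraphIso G H → GraphIso H G
giso-sym G H (π , hom) = flip π , λ i j → begin
  adj G (π ⟨$⟩ˡ i) (π ⟨$⟩ˡ j)                        ≡⟨ sym (hom _ _) ⟩
  adj H (π ⟨$⟩ʳ (π ⟨$⟩ˡ i)) (π ⟨$⟩ʳ (π ⟨$⟩ˡ j))      ≡⟨ adj-cong H (inverseʳ π) (inverseʳ π) ⟩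
  adj H i j                                          ∎
  where open ≡-Reasoning

giso-trans : ∀ {m n o} (G : Graph m) (H : Graph n) (I : Graph o) → GraphIso G H → GraphIso H I → GraphIso G I
giso-trans G H I (π , hom) (ρ , hom′) = π ∘ₚ ρ , λ i j → trans (hom′ _ _) (hom i j)

tiso-refl : ∀ {n} (G : Graph n) K → TripleIso G K G K
tiso-refl G K = idₚ , (λ _ _ → refl) , λ _ → refl

tiso-sym : ∀ {m n} (G : Graph m) K (H : Graph n) K′ → TripleIso G K H K′ → TripleIso H K′ G K
tiso-sym G K H K′ (π , hom , pres) = flip π , proj₂ (giso-sym G H (π , hom)) ,
  λ i → sym (trans (cong (lookup K′) (sym (inverseʳ π))) (pres (π ⟨$⟩ˡ i)))

tiso-trans : ∀ {m n o} (G : Graph m) K (H : Graph n) K′ (I : Graph o) K″ →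
  TripleIso G K H K′ → TripleIso H K′ I K″ → TripleIso G K I K″
tiso-trans G K H K′ I K″ (π , hom , pres) (ρ , hom′ , pres′) =
  π ∘ₚ ρ , (λ i j → trans (hom′ _ _) (hom i j)) , λ i → trans (pres′ _) (pres i)

-- Graphs of any order up to isomorphism, and partitioned graphs up to
-- triple isomorphism; every relation of Defs is one of these on a projection.

SomeGraph : Set
SomeGraph = Σ ℕ Graph

_≅_ : Rel SomeGraph 0ℓ
(_ , G) ≅ (_ , H) = GraphIso G H

≅-isEquivalence : IsEquivalence _≅_
≅-isEquivalence = record
  { refl = λ {x} → giso-refl (proj₂ x)
  ; sym = λ {x} {y} → giso-sym (proj₂ x) (proj₂ y)
  ; trans = λ {x} {y} {z} → giso-trans (proj₂ x) (proj₂ y) (proj₂ z) }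

Partitioned : ℕ → Set
Partitioned n = Graph n × Subset n

_≅ₚ_ : ∀ {n} → Rel (Partitioned n) 0ℓ
(G , K) ≅ₚ (H , K′) = TripleIso G K H K′

≅ₚ-isEquivalence : ∀ {n} → IsEquivalence (_≅ₚ_ {n})
≅ₚ-isEquivalence = record
  { refl = λ {x} → tiso-refl (proj₁ x) (proj₂ x)
  ; sym = λ {x} {y} → tiso-sym (proj₁ x) (proj₂ x) (proj₁ y) (proj₂ y)
  ; trans = λ {x} {y} {z} → tiso-trans (proj₁ x) (proj₂ x) (proj₁ y) (proj₂ y) (proj₁ z) (proj₂ z) }

Split : ℕ → Set
Split n = Σ (Graph n) IsSplit

Split≈ : ∀ {n} → Rel (Split n) 0ℓ
Split≈ (G , _) (H , _) = GraphIso G H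

KSTriple : ℕ → Set
KSTriple n = Σ (Graph n) λ G → Σ (Subset n) (IsKS G)

_≅ₜ_ : ∀ {n} → Rel (KSTriple n) 0ℓ
(G , K , _) ≅ₜ (H , K′ , _) = TripleIso G K H K′

module _ {n : ℕ} where

  U≈-isEquivalence : IsEquivalence (U≈ {n})
  U≈-isEquivalence = On.isEquivalence (λ u → n , proj₁ u) ≅-isEquivalence

  Split≈-isEquivalence : IsEquivalence (Split≈ {n})
  Split≈-isEquivalence = On.isEquivalence (λ g → n , proj₁ g) ≅-isEquivalence

  T≈-isEquivalence : IsEquivalence (T≈ {n})
  T≈-isEquivalence = On.isEquivalence (λ t → proj₁ t , proj₁ (proj₂ (proj₂ t))) ≅-isEquivalence

  UK≈-isEquivalence : IsEquivalence (UK≈ {n})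
  UK≈-isEquivalence = On.isEquivalence (λ t → proj₁ t , proj₁ (proj₂ t)) ≅ₚ-isEquivalence

  US≈-isEquivalence : IsEquivalence (US≈ {n})
  US≈-isEquivalence = On.isEquivalence (λ t → proj₁ t , proj₁ (proj₂ t)) ≅ₚ-isEquivalence

  BKS≈-isEquivalence : IsEquivalence (BKS≈ {n})
  BKS≈-isEquivalence = On.isEquivalence (λ t → proj₁ t , proj₁ (proj₂ t)) ≅ₚ-isEquivalence

  _≈∪_ : Rel (Union n) 0ℓ
  _≈∪_ = Pointwise UK≈ (Pointwise US≈ BKS≈)

  ≈∪-isEquivalence : IsEquivalence _≈∪_
  ≈∪-isEquivalence = ⊎-isEquivalence UK≈-isEquivalence (⊎-isEquivalence US≈-isEquivalence BKS≈-isEquivalence)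

  -- Union≈ of Defs is the same relation, written by clauses.
  ≈∪⇒Union≈ : ∀ x y → x ≈∪ y → Union≈ x y
  ≈∪⇒Union≈ _ _ (inj₁ e) = e
  ≈∪⇒Union≈ _ _ (inj₂ (inj₁ e)) = e
  ≈∪⇒Union≈ _ _ (inj₂ (inj₂ e)) = e

  Union≈⇒≈∪ : ∀ x y → Union≈ x y → x ≈∪ y
  Union≈⇒≈∪ (inj₁ _) (inj₁ _) e = inj₁ e
  Union≈⇒≈∪ (inj₂ (inj₁ _)) (inj₂ (inj₁ _)) e = inj₂ (inj₁ e)
  Union≈⇒≈∪ (inj₂ (inj₂ _)) (inj₂ (inj₂ _)) e = inj₂ (inj₂ e)

  Union≈-isEquivalence : IsEquivalence (Union≈ {n})
  Union≈-isEquivalence = record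
    { refl = λ {x} → ≈∪⇒Union≈ x x E.refl
    ; sym = λ {x} {y} e → ≈∪⇒Union≈ y x (E.sym (Union≈⇒≈∪ x y e))
    ; trans = λ {x} {y} {z} e f → ≈∪⇒Union≈ x z (E.trans (Union≈⇒≈∪ x y e) (Union≈⇒≈∪ y z f)) }
    where module E = IsEquivalence ≈∪-isEquivalence

module Transport {m n} (G : Graph m) (K : Subset m) (H : Graph n) (K′ : Subset n)
                 (iso : TripleIso G K H K′) where
  private
    π : Permutation m n
    π = proj₁ iso
    hom : ∀ i j → adj H (π ⟨$⟩ʳ i) (π ⟨$⟩ʳ j) ≡ adj G i j
    hom = proj₁ (proj₂ iso)
    pres : ∀ i → lookup K′ (π ⟨$⟩ʳ i) ≡ lookup K i
    pres = proj₂ (proj₂ iso)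

  pres⁻¹ : ∀ j → lookup K (π ⟨$⟩ˡ j) ≡ lookup K′ j
  pres⁻¹ j = trans (sym (pres (π ⟨$⟩ˡ j))) (cong (lookup K′) (inverseʳ π))

  hom⁻¹ : ∀ i j → adj G i (π ⟨$⟩ˡ j) ≡ adj H (π ⟨$⟩ʳ i) j
  hom⁻¹ i j = trans (sym (hom i (π ⟨$⟩ˡ j))) (cong (adj H (π ⟨$⟩ʳ i)) (inverseʳ π))

  hom⁻¹² : ∀ i j → adj G (π ⟨$⟩ˡ i) (π ⟨$⟩ˡ j) ≡ adj H i j
  hom⁻¹² i j = trans (hom⁻¹ (π ⟨$⟩ˡ i) j) (cong (λ v → adj H v j) (inverseʳ π))

  isKS : IsKS G K → IsKS H K′
  isKS ks = mkKS H K′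
    (λ i j ki kj i≢j → trans (sym (hom⁻¹² i j))
      (K-edge G ks (trans (pres⁻¹ i) ki) (trans (pres⁻¹ j) kj) (λ e → i≢j (inverse-injective e))))
    (λ i j si sj → trans (sym (hom⁻¹² i j)) (S-nonedge G ks (trans (pres⁻¹ i) si) (trans (pres⁻¹ j) sj)))
    where
    inverse-injective : ∀ {i j} → π ⟨$⟩ˡ i ≡ π ⟨$⟩ˡ j → i ≡ j
    inverse-injective {i} {j} e = trans (sym (inverseʳ π)) (trans (cong (π ⟨$⟩ʳ_) e) (inverseʳ π))

  absorbable : ∀ {s} → Absorbable G K s → Absorbable H K′ (π ⟨$⟩ʳ s)
  absorbable {s} (s∉K , s-K) = trans (pres s) s∉K ,
    λ k k∈K′ → trans (sym (hom⁻¹ s k)) (s-K (π ⟨$⟩ˡ k) (trans (pres⁻¹ k) k∈K′))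

  movable : ∀ {z} → Movable G K z → Movable H K′ (π ⟨$⟩ʳ z)
  movable {z} (z∈K , z-S) = trans (pres z) z∈K ,
    λ s s∉K′ → trans (sym (hom⁻¹ z s)) (z-S (π ⟨$⟩ˡ s) (trans (pres⁻¹ s) s∉K′))

  kGrowable : KGrowable G K → KGrowable H K′
  kGrowable (s , a) = π ⟨$⟩ʳ s , absorbable a

  sGrowable : SGrowable G K → SGrowable H K′
  sGrowable (z , mv) = π ⟨$⟩ʳ z , movable mv

module Image {m n} (G : Graph m) (H : Graph n) (gi : GraphIso G H) {K : Subset m} (ks : IsKS G K) where
  private
    π : Permutation m n
    π = proj₁ gi

  K₂ : Subset n
  K₂ = tabulate (λ j → lookup K (π ⟨$⟩ˡ j))

  iso : TripleIso G K H K₂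
  iso = π , proj₂ gi , λ i → trans (lookup∘tabulate _ (π ⟨$⟩ʳ i)) (cong (lookup K) (inverseˡ π))

  private
    module Back = Transport H K₂ G K (tiso-sym G K H K₂ iso)

  isKS : IsKS H K₂
  isKS = Transport.isKS G K H K₂ iso ks

  ¬kGrowable : ¬ KGrowable G K → ¬ KGrowable H K₂
  ¬kGrowable ¬kg = ¬kg ∘ Back.kGrowable

  ¬sGrowable : ¬ SGrowable G K → ¬ SGrowable H K₂
  ¬sGrowable ¬sg = ¬sg ∘ Back.sGrowable

balanced-invariant : ∀ {m n} (G : Graph m) (H : Graph n) → GraphIso G H → Balanced G → Balanced H
balanced-invariant G H gi (K , ks , kmax , smax) =
  I.K₂ , I.isKS , ¬KGrowable⇒KMax H I.isKS (I.¬kGrowable (KMax⇒¬KGrowable G ks kmax)) ,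
  ¬SGrowable⇒SMax H I.isKS (I.¬sGrowable (SMax⇒¬SGrowable G ks smax))
  where module I = Image G H gi ks

τ : ∀ {n} → Fin n → Fin n → Fin n → Fin n
τ = PC.transpose

τ-left : ∀ {n} (x s : Fin n) → τ x s x ≡ s
τ-left x s with x ≟ᶠ x
... | yes _ = refl
... | no x≢x = ⊥-elim (x≢x refl)

τ-right : ∀ {n} (x s : Fin n) → τ x s s ≡ x
τ-right x s with s ≟ᶠ x
... | yes refl = refl
... | no _ with s ≟ᶠ s
...   | yes _ = refl
...   | no s≢s = ⊥-elim (s≢s refl)

τ-other : ∀ {n} (x s i : Fin n) → i ≢ x → i ≢ s → τ x s i ≡ i
τ-other x s i i≢x i≢s with i ≟ᶠ x
... | yes i≡x = ⊥-elim (i≢x i≡x)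
... | no _ with i ≟ᶠ s
...   | yes i≡s = ⊥-elim (i≢s i≡s)
...   | no _ = refl

data Position {n} (x s : Fin n) : Fin n → Set where
  at-left : Position x s x
  at-right : x ≢ s → Position x s s
  elsewhere : ∀ {i} → i ≢ x → i ≢ s → Position x s i

position : ∀ {n} (x s i : Fin n) → Position x s i
position x s i with i ≟ᶠ x | i ≟ᶠ s
... | yes refl | _ = at-left
... | no i≢x | yes refl = at-right (λ x≡i → i≢x (sym x≡i))
... | no i≢x | no i≢s = elsewhere i≢x i≢s

Twins : ∀ {n} → Graph n → Fin n → Fin n → Set
Twins G x s = ∀ v → v ≢ x → v ≢ s → adj G x v ≡ adj G s v

twin-automorphism : ∀ {n} (G : Graph n) {x s} → Twins G x s → ∀ i j → adj G (τ x s i) (τ x s j) ≡ adj G i j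
twin-automorphism G {x} {s} tw i j with position x s i | position x s j
... | at-left | at-left = trans (Graph.irrefl G _) (sym (Graph.irrefl G x))
... | at-left | at-right _ = trans (adj-cong G (τ-left x s) (τ-right x s)) (Graph.sym G s x)
... | at-left | elsewhere j≢x j≢s = trans (adj-cong G (τ-left x s) (τ-other x s j j≢x j≢s)) (sym (tw j j≢x j≢s))
... | at-right _ | at-left = trans (adj-cong G (τ-right x s) (τ-left x s)) (Graph.sym G x s)
... | at-right _ | at-right _ = trans (Graph.irrefl G _) (sym (Graph.irrefl G s))
... | at-right _ | elsewhere j≢x j≢s = trans (adj-cong G (τ-right x s) (τ-other x s j j≢x j≢s)) (tw j j≢x j≢s)
... | elsewhere i≢x i≢s | at-left = trans (adj-cong G (τ-other x s i i≢x i≢s) (τ-left x s))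
  (trans (Graph.sym G i s) (trans (sym (tw i i≢x i≢s)) (Graph.sym G x i)))
... | elsewhere i≢x i≢s | at-right _ = trans (adj-cong G (τ-other x s i i≢x i≢s) (τ-right x s))
  (trans (Graph.sym G i x) (trans (tw i i≢x i≢s) (Graph.sym G s i)))
... | elsewhere i≢x i≢s | elsewhere j≢x j≢s = adj-cong G (τ-other x s i i≢x i≢s) (τ-other x s j j≢x j≢s)

twin-swap : ∀ {n} (G : Graph n) K K′ {x s} → Twins G x s →
  (∀ i → lookup K′ (τ x s i) ≡ lookup K i) → TripleIso G K G K′
twin-swap G K K′ {x} {s} tw pres = transposeₚ x s , twin-automorphism G tw , pres

-- Uniqueness of K-max and S-max partitions up to isomorphism.

same-partition : ∀ {n} (G : Graph n) K K′ → K ⊆ᵇ K′ → K′ ⊆ᵇ K → TripleIso G K G K′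
same-partition G K K′ K⊆K′ K′⊆K = idₚ , (λ _ _ → refl) , pres
  where
  pres : ∀ i → lookup K′ i ≡ lookup K i
  pres i with In-or-Out K i | In-or-Out K′ i
  ... | inj₁ ki | _ = trans (K⊆K′ i ki) (sym ki)
  ... | inj₂ si | inj₁ k′i = ⊥-elim (In-Out (K′⊆K i k′i) si)
  ... | inj₂ si | inj₂ s′i = trans s′i (sym si)

⊆ᵇ-Out : ∀ {n} (K K′ : Subset n) → K ⊆ᵇ K′ → ∀ i → Out K′ i → Out K i
⊆ᵇ-Out K K′ K⊆K′ i s′i with In-or-Out K i
... | inj₁ ki = ⊥-elim (In-Out (K⊆K′ i ki) s′i)
... | inj₂ si = si

module _ {n} (G : Graph n) {K K′ : Subset n} (ks : IsKS G K) (ks′ : IsKS G K′) where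

  -- If x ∈ K ∖ K′ and s ∈ K′ ∖ K, the partitions agree elsewhere (else a
  -- vertex would lie in a clique and a stable set with x or s), x and s are
  -- twins, and swapping them maps K onto K′.
  swap-partitions : ∀ {x s} → In K x → Out K′ x → Out K s → In K′ s → TripleIso G K G K′
  swap-partitions {x} {s} x∈K x∉K′ s∉K s∈K′ = twin-swap G K K′ twins pres
    where
    agree : ∀ i → i ≢ x → i ≢ s → lookup K i ≡ lookup K′ i
    agree i i≢x i≢s with In-or-Out K i | In-or-Out K′ i
    ... | inj₁ ki | inj₁ k′i = trans ki (sym k′i)
    ... | inj₁ ki | inj₂ s′i = ⊥-elim (In-Out (K-edge G ks ki x∈K i≢x) (S-nonedge G ks′ s′i x∉K′))
    ... | inj₂ si | inj₁ k′i = ⊥-elim (In-Out (K-edge G ks′ k′i s∈K′ i≢s) (S-nonedge G ks si s∉K))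
    ... | inj₂ si | inj₂ s′i = trans si (sym s′i)
    twins : Twins G x s
    twins v v≢x v≢s with In-or-Out K v
    ... | inj₁ vk = trans (K-edge G ks x∈K vk (v≢x ∘ sym))
                          (sym (K-edge G ks′ s∈K′ (trans (sym (agree v v≢x v≢s)) vk) (v≢s ∘ sym)))
    ... | inj₂ vs = trans (S-nonedge G ks′ x∉K′ (trans (sym (agree v v≢x v≢s)) vs)) (sym (S-nonedge G ks s∉K vs))
    pres : ∀ i → lookup K′ (τ x s i) ≡ lookup K i
    pres i with position x s i
    ... | at-left = trans (cong (lookup K′) (τ-left x s)) (trans s∈K′ (sym x∈K))
    ... | at-right _ = trans (cong (lookup K′) (τ-right x s)) (trans x∉K′ (sym s∉K))
    ... | elsewhere i≢x i≢s = trans (cong (lookup K′) (τ-other x s i i≢x i≢s)) (sym (agree i i≢x i≢s))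

  compare-partitions : K ⊆ᵇ K′ ⊎ K′ ⊆ᵇ K ⊎ TripleIso G K G K′
  compare-partitions with any? (λ x → In? K x ×-dec Out? K′ x) | any? (λ s → Out? K s ×-dec In? K′ s)
  ... | no K∖K′=∅ | _ = inj₁ λ i ki → no-difference K∖K′=∅ ki
    where
    no-difference : ¬ (∃ λ x → In K x × Out K′ x) → ∀ {i} → In K i → In K′ i
    no-difference none {i} ki with In-or-Out K′ i
    ... | inj₁ k′i = k′i
    ... | inj₂ s′i = ⊥-elim (none (i , ki , s′i))
  ... | yes _ | no K′∖K=∅ = inj₂ (inj₁ λ i k′i → no-difference K′∖K=∅ k′i)
    where
    no-difference : ¬ (∃ λ s → Out K s × In K′ s) → ∀ {i} → In K′ i → In K i
    no-difference none {i} k′i with In-or-Out K i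
    ... | inj₁ ki = ki
    ... | inj₂ si = ⊥-elim (none (i , si , k′i))
  ... | yes (x , x∈K , x∉K′) | yes (s , s∉K , s∈K′) = inj₂ (inj₂ (swap-partitions x∈K x∉K′ s∉K s∈K′))

-- K ⊆ K′ with K unable to grow forces K = K′: a vertex of K′ ∖ K would be absorbable.
⊆∧¬KGrowable⇒⊇ : ∀ {n} (G : Graph n) K K′ → IsKS G K′ → K ⊆ᵇ K′ → ¬ KGrowable G K → K′ ⊆ᵇ K
⊆∧¬KGrowable⇒⊇ G K K′ ks′ K⊆K′ ¬kg i k′i with In-or-Out K i
... | inj₁ ki = ki
... | inj₂ si = ⊥-elim (¬kg (i , si , λ k ki → K-edge G ks′ k′i (K⊆K′ k ki) (λ i≡k → In≢Out K ki si (sym i≡k))))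

-- K ⊆ K′ with S′ unable to grow forces K = K′: a vertex of K′ ∖ K would be movable.
⊆∧¬SGrowable⇒⊇ : ∀ {n} (G : Graph n) K K′ → IsKS G K → K ⊆ᵇ K′ → ¬ SGrowable G K′ → K′ ⊆ᵇ K
⊆∧¬SGrowable⇒⊇ G K K′ ks K⊆K′ ¬sg i k′i with In-or-Out K i
... | inj₁ ki = ki
... | inj₂ si = ⊥-elim (¬sg (i , k′i , λ t s′t → S-nonedge G ks si (⊆ᵇ-Out K K′ K⊆K′ t s′t)))

kmax-unique : ∀ {n} (G : Graph n) {K K′} → IsKS G K → IsKS G K′ →
  ¬ KGrowable G K → ¬ KGrowable G K′ → TripleIso G K G K′
kmax-unique G {K} {K′} ks ks′ ¬kg ¬kg′ with compare-partitions G ks ks′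
... | inj₁ K⊆K′ = same-partition G K K′ K⊆K′ (⊆∧¬KGrowable⇒⊇ G K K′ ks′ K⊆K′ ¬kg)
... | inj₂ (inj₁ K′⊆K) = same-partition G K K′ (⊆∧¬KGrowable⇒⊇ G K′ K ks K′⊆K ¬kg′) K′⊆K
... | inj₂ (inj₂ swap) = swap

smax-unique : ∀ {n} (G : Graph n) {K K′} → IsKS G K → IsKS G K′ →
  ¬ SGrowable G K → ¬ SGrowable G K′ → TripleIso G K G K′
smax-unique G {K} {K′} ks ks′ ¬sg ¬sg′ with compare-partitions G ks ks′
... | inj₁ K⊆K′ = same-partition G K K′ K⊆K′ (⊆∧¬SGrowable⇒⊇ G K K′ ks K⊆K′ ¬sg′)
... | inj₂ (inj₁ K′⊆K) = same-partition G K K′ (⊆∧¬SGrowable⇒⊇ G K′ K ks′ K′⊆K ¬sg) K′⊆K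
... | inj₂ (inj₂ swap) = swap

-- Classification of KS-triples: a KS-partition is in U^K if only S can
-- grow, in U^S if K can grow, and in B^KS if neither can.

triple : ∀ {m} → Union m → KSTriple m
triple (inj₁ (G , K , _ , ks , _)) = G , K , ks
triple (inj₂ (inj₁ (G , K , _ , ks , _))) = G , K , ks
triple (inj₂ (inj₂ (G , K , ks , _))) = G , K , ks

classify : ∀ {m} → KSTriple m → Union m
classify (G , K , ks) with KGrowable? G K
... | yes kg = inj₂ (inj₁ (G , K , SMax∧¬KMax⇒Unbalanced G ks smax (λ kmax → KMax⇒¬KGrowable G ks kmax kg) , ks , smax))
  where
  smax : SMax G K
  smax = ¬SGrowable⇒SMax G ks (KGrowable⇒¬SGrowable G K kg)
... | no ¬kg with SGrowable? G K
...   | yes sg = inj₁ (G , K , KMax∧¬SMax⇒Unbalanced G ks kmax (λ smax → SMax⇒¬SGrowable G ks smax sg) , ks , kmax)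
  where
  kmax : KMax G K
  kmax = ¬KGrowable⇒KMax G ks ¬kg
...   | no ¬sg = inj₂ (inj₂ (G , K , ks , ¬KGrowable⇒KMax G ks ¬kg , ¬SGrowable⇒SMax G ks ¬sg))

triple-classify : ∀ {m} (t : KSTriple m) → triple (classify t) ≡ t
triple-classify (G , K , ks) with KGrowable? G K
... | yes _ = refl
... | no _ with SGrowable? G K
...   | yes _ = refl
...   | no _ = refl

-- Isomorphic triples fall in the same class, since growth is transported.
classify-resp : ∀ {m} (t t′ : KSTriple m) → t ≅ₜ t′ → classify t ≈∪ classify t′
classify-resp (G , K , ks) (G′ , K′ , ks′) iso with KGrowable? G K | KGrowable? G′ K′
... | yes _ | yes _ = inj₂ (inj₁ iso)
... | yes kg | no ¬kg′ = ⊥-elim (¬kg′ (Transport.kGrowable G K G′ K′ iso kg))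
... | no ¬kg | yes kg′ = ⊥-elim (¬kg (Transport.kGrowable G′ K′ G K (tiso-sym G K G′ K′ iso) kg′))
... | no _ | no _ with SGrowable? G K | SGrowable? G′ K′
...   | yes _ | yes _ = inj₁ iso
...   | yes sg | no ¬sg′ = ⊥-elim (¬sg′ (Transport.sGrowable G K G′ K′ iso sg))
...   | no ¬sg | yes sg′ = ⊥-elim (¬sg (Transport.sGrowable G′ K′ G K (tiso-sym G K G′ K′ iso) sg′))
...   | no _ | no _ = inj₂ (inj₂ iso)

≈∪⇒≅ₜ : ∀ {m} (x y : Union m) → x ≈∪ y → triple x ≅ₜ triple y
≈∪⇒≅ₜ _ _ (inj₁ iso) = iso
≈∪⇒≅ₜ _ _ (inj₂ (inj₁ iso)) = iso
≈∪⇒≅ₜ _ _ (inj₂ (inj₂ iso)) = iso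

classify-reflect : ∀ {m} (t t′ : KSTriple m) → classify t ≈∪ classify t′ → t ≅ₜ t′
classify-reflect t t′ r =
  subst₂ _≅ₜ_ (triple-classify t) (triple-classify t′) (≈∪⇒≅ₜ (classify t) (classify t′) r)

classify-triple : ∀ {m} (u : Union m) → classify (triple u) ≈∪ u
classify-triple (inj₁ (G , K , unb , ks , kmax)) with KGrowable? G K
... | yes kg = ⊥-elim (KMax⇒¬KGrowable G ks kmax kg)
... | no _ with SGrowable? G K
...   | yes _ = inj₁ (tiso-refl G K)
...   | no ¬sg = ⊥-elim (proj₂ unb (K , ks , kmax , ¬SGrowable⇒SMax G ks ¬sg))
classify-triple (inj₂ (inj₁ (G , K , unb , ks , smax))) with KGrowable? G K
... | yes _ = inj₂ (inj₁ (tiso-refl G K))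
... | no ¬kg = ⊥-elim (proj₂ unb (K , ks , ¬KGrowable⇒KMax G ks ¬kg , smax))
classify-triple (inj₂ (inj₂ (G , K , ks , kmax , smax))) with KGrowable? G K
... | yes kg = ⊥-elim (KMax⇒¬KGrowable G ks kmax kg)
... | no _ with SGrowable? G K
...   | yes sg = ⊥-elim (SMax⇒¬SGrowable G ks smax sg)
...   | no _ = inj₂ (inj₂ (tiso-refl G K))

classification : ∀ {m} → QuotBij (_≅ₜ_ {m}) (_≈∪_ {m})
classification = classify , classify-resp , classify-reflect , λ u → triple u , classify-triple u

delete : ∀ {m} → Graph (suc m) → Fin (suc m) → Graph m
delete G z = record
  { adj = λ i j → adj G (punchIn z i) (punchIn z j)
  ; sym = λ i j → Graph.sym G (punchIn z i) (punchIn z j)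
  ; irrefl = λ i → Graph.irrefl G (punchIn z i) }

deleteₛ : ∀ {m} → Subset (suc m) → Fin (suc m) → Subset m
deleteₛ K z = tabulate (λ i → lookup K (punchIn z i))

lookup-deleteₛ : ∀ {m} (K : Subset (suc m)) z i → lookup (deleteₛ K z) i ≡ lookup K (punchIn z i)
lookup-deleteₛ K z i = lookup∘tabulate _ i

delete-KS : ∀ {m} (G : Graph (suc m)) {K} z → IsKS G K → IsKS (delete G z) (deleteₛ K z)
delete-KS G {K} z ks = mkKS (delete G z) (deleteₛ K z)
  (λ i j ki kj i≢j → K-edge G ks (old i ki) (old j kj) (i≢j ∘ punchIn-injective z i j))
  (λ i j si sj → S-nonedge G ks (old i si) (old j sj))
  where
  old : ∀ {b} i → lookup (deleteₛ K z) i ≡ b → lookup K (punchIn z i) ≡ b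
  old i e = trans (sym (lookup-deleteₛ K z i)) e

data PunchView {m} (z : Fin (suc m)) : Fin (suc m) → Set where
  deleted : PunchView z z
  kept : ∀ j → PunchView z (punchIn z j)

punch-view : ∀ {m} (z i : Fin (suc m)) → PunchView z i
punch-view z i with z ≟ᶠ i
... | yes refl = deleted
... | no z≢i = subst (PunchView z) (punchIn-punchOut z≢i) (kept (punchOut z≢i))

insert-deleted : ∀ {m} (z z′ : Fin (suc m)) (ρ : Permutation m m) → insert z z′ ρ ⟨$⟩ʳ z ≡ z′
insert-deleted z z′ ρ with z ≟ᶠ z
... | yes _ = refl
... | no z≢z = ⊥-elim (z≢z refl)

movable-adj : ∀ {n} (G : Graph n) {K} → IsKS G K → ∀ {z} → Movable G K z → ∀ v → v ≢ z → adj G z v ≡ lookup K v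
movable-adj G {K} ks (z∈K , z-S) v v≢z with In-or-Out K v
... | inj₁ vk = trans (K-edge G ks z∈K vk (v≢z ∘ sym)) (sym vk)
... | inj₂ vs = trans (z-S v vs) (sym vs)

movable-swap : ∀ {n} (G : Graph n) {K} → IsKS G K → ∀ {z₁ z₂} → Movable G K z₁ → Movable G K z₂ → TripleIso G K G K
movable-swap G {K} ks {z₁} {z₂} m₁ m₂ = twin-swap G K K twins pres
  where
  twins : Twins G z₁ z₂
  twins v v≢z₁ v≢z₂ = trans (movable-adj G ks m₁ v v≢z₁) (sym (movable-adj G ks m₂ v v≢z₂))
  pres : ∀ i → lookup K (τ z₁ z₂ i) ≡ lookup K i
  pres i with position z₁ z₂ i
  ... | at-left = trans (cong (lookup K) (τ-left z₁ z₂)) (trans (proj₁ m₂) (sym (proj₁ m₁)))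
  ... | at-right _ = trans (cong (lookup K) (τ-right z₁ z₂)) (trans (proj₁ m₁) (sym (proj₁ m₂)))
  ... | elsewhere i≢z₁ i≢z₂ = cong (lookup K) (τ-other z₁ z₂ i i≢z₁ i≢z₂)

delete-iso : ∀ {m} (G : Graph (suc m)) K (G′ : Graph (suc m)) K′ (iso : TripleIso G K G′ K′) z →
  TripleIso (delete G z) (deleteₛ K z) (delete G′ (proj₁ iso ⟨$⟩ʳ z)) (deleteₛ K′ (proj₁ iso ⟨$⟩ʳ z))
delete-iso G K G′ K′ (σ , hom , pres) z = remove z σ ,
  (λ i j → trans (adj-cong G′ (sym (punchIn-permute σ z i)) (sym (punchIn-permute σ z j)))
                 (hom (punchIn z i) (punchIn z j))) ,
  λ i → begin
    lookup (deleteₛ K′ (σ ⟨$⟩ʳ z)) (remove z σ ⟨$⟩ʳ i)  ≡⟨ lookup-deleteₛ K′ _ _ ⟩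
    lookup K′ (punchIn (σ ⟨$⟩ʳ z) (remove z σ ⟨$⟩ʳ i))  ≡⟨ cong (lookup K′) (sym (punchIn-permute σ z i)) ⟩
    lookup K′ (σ ⟨$⟩ʳ punchIn z i)                      ≡⟨ pres (punchIn z i) ⟩
    lookup K (punchIn z i)                              ≡⟨ sym (lookup-deleteₛ K z i) ⟩
    lookup (deleteₛ K z) i                              ∎
  where open ≡-Reasoning

module _ {m} (G : Graph (suc m)) (K : Subset (suc m)) (G′ : Graph (suc m)) (K′ : Subset (suc m))
         (z z′ : Fin (suc m)) where

  -- Deleting movable vertices respects isomorphism: an isomorphism maps z to
  -- a movable vertex, which is a twin of z′.
  delete-resp : IsKS G′ K′ → Movable G K z → Movable G′ K′ z′ →
    TripleIso G K G′ K′ → TripleIso (delete G z) (deleteₛ K z) (delete G′ z′) (deleteₛ K′ z′)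
  delete-resp ks′ mz mz′ iso =
    subst (λ w → TripleIso (delete G z) (deleteₛ K z) (delete G′ w) (deleteₛ K′ w)) (τ-left (σ ⟨$⟩ʳ z) z′)
      (delete-iso G K G′ K′ iso′ z)
    where
    σ : Permutation (suc m) (suc m)
    σ = proj₁ iso
    iso′ : TripleIso G K G′ K′
    iso′ = tiso-trans G K G′ K′ G′ K′ iso (movable-swap G′ ks′ (Transport.movable G K G′ K′ iso mz) mz′)

  -- Conversely an isomorphism of the deletions extends by z ↦ z′, since the
  -- deleted vertices are adjacent exactly to K and to K′.
  delete-reflect : IsKS G K → IsKS G′ K′ → Movable G K z → Movable G′ K′ z′ →
    TripleIso (delete G z) (deleteₛ K z) (delete G′ z′) (deleteₛ K′ z′) → TripleIso G K G′ K′
  delete-reflect ks ks′ mz mz′ (ρ , hom , pres) = σ , hom₊ , pres₊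
    where
    σ : Permutation (suc m) (suc m)
    σ = insert z z′ ρ
    pres-kept : ∀ j → lookup K′ (punchIn z′ (ρ ⟨$⟩ʳ j)) ≡ lookup K (punchIn z j)
    pres-kept j = trans (sym (lookup-deleteₛ K′ z′ (ρ ⟨$⟩ʳ j))) (trans (pres j) (lookup-deleteₛ K z j))
    adj-deleted : ∀ j → adj G′ z′ (punchIn z′ (ρ ⟨$⟩ʳ j)) ≡ adj G z (punchIn z j)
    adj-deleted j = trans (movable-adj G′ ks′ mz′ _ (punchInᵢ≢i z′ _))
      (trans (pres-kept j) (sym (movable-adj G ks mz _ (punchInᵢ≢i z j))))
    hom₊ : ∀ i j → adj G′ (σ ⟨$⟩ʳ i) (σ ⟨$⟩ʳ j) ≡ adj G i j
    hom₊ i j with punch-view z i | punch-view z j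
    ... | deleted | deleted =
      trans (adj-cong G′ (insert-deleted z z′ ρ) (insert-deleted z z′ ρ)) (trans (Graph.irrefl G′ z′) (sym (Graph.irrefl G z)))
    ... | deleted | kept j′ = trans (adj-cong G′ (insert-deleted z z′ ρ) (insert-punchIn z z′ ρ j′)) (adj-deleted j′)
    ... | kept i′ | deleted = trans (adj-cong G′ (insert-punchIn z z′ ρ i′) (insert-deleted z z′ ρ))
      (trans (Graph.sym G′ _ z′) (trans (adj-deleted i′) (Graph.sym G z _)))
    ... | kept i′ | kept j′ = trans (adj-cong G′ (insert-punchIn z z′ ρ i′) (insert-punchIn z z′ ρ j′)) (hom i′ j′)
    pres₊ : ∀ i → lookup K′ (σ ⟨$⟩ʳ i) ≡ lookup K i
    pres₊ i with punch-view z i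
    ... | deleted = trans (cong (lookup K′) (insert-deleted z z′ ρ)) (trans (proj₁ mz′) (sym (proj₁ mz)))
    ... | kept i′ = trans (cong (lookup K′) (insert-punchIn z z′ ρ i′)) (pres-kept i′)

attach : ∀ {m} → Graph m → Subset m → Graph (suc m)
attach H K = record { adj = adj₊ ; sym = sym₊ ; irrefl = irrefl₊ }
  where
  adj₊ : Fin _ → Fin _ → Bool
  adj₊ zero zero = false
  adj₊ zero (suc j) = lookup K j
  adj₊ (suc i) zero = lookup K i
  adj₊ (suc i) (suc j) = adj H i j
  sym₊ : ∀ i j → adj₊ i j ≡ adj₊ j i
  sym₊ zero zero = refl
  sym₊ zero (suc j) = refl
  sym₊ (suc i) zero = refl
  sym₊ (suc i) (suc j) = Graph.sym H i j
  irrefl₊ : ∀ i → adj₊ i i ≡ false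
  irrefl₊ zero = refl
  irrefl₊ (suc i) = Graph.irrefl H i

-- Attaching a vertex to the clique of a KS-triple gives a member of U^K in
-- which the new vertex is movable; deleting it gives back the triple.
module Attach {m} (H : Graph m) {K : Subset m} (ks : IsKS H K) where
  G : Graph (suc m)
  G = attach H K

  K₊ : Subset (suc m)
  K₊ = true ∷ K

  isKS : IsKS G K₊
  isKS = mkKS G K₊ clique stable
    where
    clique : ∀ i j → In K₊ i → In K₊ j → i ≢ j → Edge G i j
    clique zero zero _ _ 0≢0 = ⊥-elim (0≢0 refl)
    clique zero (suc j) _ kj _ = kj
    clique (suc i) zero ki _ _ = ki
    clique (suc i) (suc j) ki kj i≢j = K-edge H ks ki kj (i≢j ∘ cong suc)
    stable : ∀ i j → Out K₊ i → Out K₊ j → adj G i j ≡ false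
    stable (suc i) (suc j) si sj = S-nonedge H ks si sj

  apex-movable : Movable G K₊ zero
  apex-movable = refl , λ { (suc s) s∉K → s∉K }

  -- A vertex of S is absorbable only if adjacent to the new vertex, i.e. in K.
  ¬kGrowable : ¬ KGrowable G K₊
  ¬kGrowable (suc s , s∉K , s-K₊) = In-Out (s-K₊ zero refl) s∉K

  kmax : KMax G K₊
  kmax = ¬KGrowable⇒KMax G isKS ¬kGrowable

  member : UK (suc m)
  member = G , K₊ , KMax∧¬SMax⇒Unbalanced G isKS kmax (λ smax → SMax⇒¬SGrowable G isKS smax (zero , apex-movable)) ,
           isKS , kmax

  delete-apex : TripleIso (delete G zero) (deleteₛ K₊ zero) H K
  delete-apex = idₚ , (λ _ _ → refl) , λ i → sym (lookup-deleteₛ K₊ zero i)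

movable-vertex : ∀ {m} (a : UK m) → SGrowable (proj₁ a) (proj₁ (proj₂ a))
movable-vertex (G , K , unb , ks , kmax) = Unbalanced∧KMax⇒SGrowable G ks unb kmax

delete-movable : ∀ {m} → UK (suc m) → KSTriple m
delete-movable a@(G , K , _ , ks , _) with movable-vertex a
... | z , _ = delete G z , deleteₛ K z , delete-KS G z ks

deletion : ∀ {m} → QuotBij (UK≈ {suc m}) (_≅ₜ_ {m})
deletion = delete-movable , resp , reflect , surj
  where
  resp : ∀ a a′ → UK≈ a a′ → delete-movable a ≅ₜ delete-movable a′
  resp a@(G , K , _) a′@(G′ , K′ , _ , ks′ , _) =
    delete-resp G K G′ K′ (proj₁ (movable-vertex a)) (proj₁ (movable-vertex a′)) ks′ (proj₂ (movable-vertex a)) (proj₂ (movable-vertex a′))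
  reflect : ∀ a a′ → delete-movable a ≅ₜ delete-movable a′ → UK≈ a a′
  reflect a@(G , K , _ , ks , _) a′@(G′ , K′ , _ , ks′ , _) =
    delete-reflect G K G′ K′ (proj₁ (movable-vertex a)) (proj₁ (movable-vertex a′)) ks ks′ (proj₂ (movable-vertex a)) (proj₂ (movable-vertex a′))
  surj : ∀ t → ∃ λ a → delete-movable a ≅ₜ t
  surj (H , K , ks) = A.member ,
    tiso-trans (proj₁ (delete-movable A.member)) (proj₁ (proj₂ (delete-movable A.member))) (delete A.G zero) (deleteₛ A.K₊ zero) H K
      (delete-resp A.G A.K₊ A.G A.K₊ (proj₁ (movable-vertex A.member)) zero A.isKS (proj₂ (movable-vertex A.member)) A.apex-movable (tiso-refl A.G A.K₊))
      A.delete-apex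
    where module A = Attach H ks

-- Forgetting the partition: U_n^K and U_n^S are both in bijection with U_n,
-- because K-max (S-max) partitions are unique up to isomorphism.

-- Across a graph isomorphism: carry K over to H and compare it there with K′.
module _ {m n} (G : Graph m) (H : Graph n) (gi : GraphIso G H) {K : Subset m} {K′ : Subset n}
         (ks : IsKS G K) (ks′ : IsKS H K′) where
  private module I = Image G H gi ks

  kmax-unique-iso : ¬ KGrowable G K → ¬ KGrowable H K′ → TripleIso G K H K′
  kmax-unique-iso ¬kg ¬kg′ = tiso-trans G K H I.K₂ H K′ I.iso (kmax-unique H I.isKS ks′ (I.¬kGrowable ¬kg) ¬kg′)

  smax-unique-iso : ¬ SGrowable G K → ¬ SGrowable H K′ → TripleIso G K H K′
  smax-unique-iso ¬sg ¬sg′ = tiso-trans G K H I.K₂ H K′ I.iso (smax-unique H I.isKS ks′ (I.¬sGrowable ¬sg) ¬sg′)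

forget-K : ∀ {n} → QuotBij (UK≈ {n}) (U≈ {n})
forget-K = (λ { (G , _ , unb , _) → G , unb }) , (λ { _ _ (π , hom , _) → π , hom }) , reflect , surj
  where
  reflect : ∀ a a′ → GraphIso (proj₁ a) (proj₁ a′) → UK≈ a a′
  reflect (G , K , _ , ks , kmax) (G′ , K′ , _ , ks′ , kmax′) gi =
    kmax-unique-iso G G′ gi ks ks′ (KMax⇒¬KGrowable G ks kmax) (KMax⇒¬KGrowable G′ ks′ kmax′)
  surj : ∀ u → ∃ λ a → GraphIso (proj₁ a) (proj₁ u)
  surj (G , unb) with kmax-partition G (proj₁ unb)
  ... | K , ks , ¬kg = (G , K , unb , ks , ¬KGrowable⇒KMax G ks ¬kg) , giso-refl G

forget-S : ∀ {n} → QuotBij (US≈ {n}) (U≈ {n})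
forget-S = (λ { (G , _ , unb , _) → G , unb }) , (λ { _ _ (π , hom , _) → π , hom }) , reflect , surj
  where
  reflect : ∀ a a′ → GraphIso (proj₁ a) (proj₁ a′) → US≈ a a′
  reflect (G , K , _ , ks , smax) (G′ , K′ , _ , ks′ , smax′) gi =
    smax-unique-iso G G′ gi ks ks′ (SMax⇒¬SGrowable G ks smax) (SMax⇒¬SGrowable G′ ks′ smax′)
  surj : ∀ u → ∃ λ a → GraphIso (proj₁ a) (proj₁ u)
  surj (G , unb) with smax-partition G (proj₁ unb)
  ... | K , ks , ¬sg = (G , K , unb , ks , ¬SGrowable⇒SMax G ks ¬sg) , giso-refl G

balanced-or-unbalanced : ∀ {n} (G : Graph n) {K} → IsKS G K → (KMax G K × SMax G K) ⊎ Unbalanced G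
balanced-or-unbalanced G {K} ks with KGrowable? G K
... | yes kg = inj₂ (SMax∧¬KMax⇒Unbalanced G ks (¬SGrowable⇒SMax G ks (KGrowable⇒¬SGrowable G K kg))
                                                 (λ kmax → KMax⇒¬KGrowable G ks kmax kg))
... | no ¬kg with SGrowable? G K
...   | yes sg = inj₂ (KMax∧¬SMax⇒Unbalanced G ks (¬KGrowable⇒KMax G ks ¬kg) (λ smax → SMax⇒¬SGrowable G ks smax sg))
...   | no ¬sg = inj₁ (¬KGrowable⇒KMax G ks ¬kg , ¬SGrowable⇒SMax G ks ¬sg)

split-decomposition : ∀ {n} → QuotBij (Pointwise (U≈ {n}) (BKS≈ {n})) (Split≈ {n})
split-decomposition {n} = split , resp , reflect , surj
  where
  split : U n ⊎ BKS n → Split n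
  split (inj₁ (G , unb)) = G , proj₁ unb
  split (inj₂ (G , K , ks , _)) = G , K , ks
  resp : ∀ x y → Pointwise U≈ BKS≈ x y → Split≈ (split x) (split y)
  resp _ _ (inj₁ gi) = gi
  resp _ _ (inj₂ (π , hom , _)) = π , hom
  reflect : ∀ x y → Split≈ (split x) (split y) → Pointwise U≈ BKS≈ x y
  reflect (inj₁ _) (inj₁ _) gi = inj₁ gi
  reflect (inj₁ (G , unb)) (inj₂ (G′ , K′ , ks′ , kmax′ , smax′)) gi =
    ⊥-elim (proj₂ unb (balanced-invariant G′ G (giso-sym G G′ gi) (K′ , ks′ , kmax′ , smax′)))
  reflect (inj₂ (G , K , ks , kmax , smax)) (inj₁ (G′ , unb′)) gi =
    ⊥-elim (proj₂ unb′ (balanced-invariant G G′ gi (K , ks , kmax , smax)))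
  reflect (inj₂ (G , K , ks , kmax , _)) (inj₂ (G′ , K′ , ks′ , kmax′ , _)) gi =
    inj₂ (kmax-unique-iso G G′ gi ks ks′ (KMax⇒¬KGrowable G ks kmax) (KMax⇒¬KGrowable G′ ks′ kmax′))
  surj : ∀ g → ∃ λ x → Split≈ (split x) g
  surj (G , K , ks) with balanced-or-unbalanced G ks
  ... | inj₁ (kmax , smax) = inj₂ (G , K , ks , kmax , smax) , giso-refl G
  ... | inj₂ unb = inj₁ (G , unb) , giso-refl G

T-step : ∀ {m} → QuotBij (Pointwise (T≈ {m}) (Split≈ {suc m})) (T≈ {suc m})
T-step {m} = include , resp , reflect , surj
  where
  include : T≤ m ⊎ Split (suc m) → T≤ (suc m)
  include (inj₁ (k , k≤m , G , sp)) = k , m≤n⇒m≤1+n k≤m , G , sp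
  include (inj₂ (G , sp)) = suc m , ≤-refl , G , sp
  resp : ∀ x y → Pointwise T≈ Split≈ x y → T≈ (include x) (include y)
  resp _ _ (inj₁ gi) = gi
  resp _ _ (inj₂ gi) = gi
  -- isomorphic graphs have the same number of vertices
  reflect : ∀ x y → T≈ (include x) (include y) → Pointwise T≈ Split≈ x y
  reflect (inj₁ _) (inj₁ _) gi = inj₁ gi
  reflect (inj₂ _) (inj₂ _) gi = inj₂ gi
  reflect (inj₁ (k , k≤m , _)) (inj₂ _) (π , _) = ⊥-elim (<-irrefl (↔⇒≡ π) (s≤s k≤m))
  reflect (inj₂ _) (inj₁ (k , k≤m , _)) (π , _) = ⊥-elim (<-irrefl (sym (↔⇒≡ π)) (s≤s k≤m))
  surj : ∀ t → ∃ λ x → T≈ (include x) t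
  surj (k , k≤1+m , G , sp) with k ≤? m
  ... | yes k≤m = inj₁ (k , k≤m , G , sp) , giso-refl G
  ... | no k≰m with ≤-antisym k≤1+m (≰⇒> k≰m)
  ...   | refl = inj₂ (G , sp) , giso-refl G

T-base : QuotBij (Split≈ {0}) (T≈ {0})
T-base = (λ { (G , sp) → 0 , z≤n , G , sp }) , (λ _ _ gi → gi) , (λ _ _ gi → gi) , surj
  where
  surj : ∀ t → ∃ λ g → GraphIso (proj₁ g) (proj₁ (proj₂ (proj₂ t)))
  surj (zero , z≤n , G , sp) = (G , sp) , giso-refl G

-- The null graph is balanced.
U₀-empty : ¬ U 0
U₀-empty (G , _ , ¬bal) = ¬bal ([] , ((λ ()) , (λ ())) , (λ { [] _ → z≤n }) , (λ { [] _ → z≤n }))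

-- U_{m+1} ≅ U^K_{m+1} ≅ KS-triples on m vertices ≅ U^K_m ∪ U^S_m ∪ B^KS_m
--         ≅ U_m ⊎ (U_m ⊎ B^KS_m) ≅ U_m ⊎ Split_m.

UK-decomposition : ∀ {m} → QuotBij (UK≈ {suc m}) (_≈∪_ {m})
UK-decomposition = qb-comp ≈∪-isEquivalence deletion classification

U-step : ∀ m → QuotBij (U≈ {suc m}) (Pointwise (U≈ {m}) (Split≈ {m}))
U-step m =
  qb-comp E (qb-inv U≈-isEquivalence forget-K) (
  qb-comp E UK-decomposition (
  qb-comp E (qb-sum forget-K (qb-sum forget-S (qb-id BKS≈-isEquivalence)))
            (qb-sum (qb-id U≈-isEquivalence) split-decomposition)))
  where
  E : IsEquivalence (Pointwise (U≈ {m}) (Split≈ {m}))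
  E = ⊎-isEquivalence U≈-isEquivalence Split≈-isEquivalence

U-count : ∀ m → QuotBij (U≈ {suc m}) (T≈ {m})
U-count zero =
  qb-comp T≈-isEquivalence (U-step 0) (qb-comp T≈-isEquivalence (qb-drop-empty Split≈-isEquivalence U₀-empty) T-base)
U-count (suc m) =
  qb-comp T≈-isEquivalence (U-step (suc m)) (qb-comp T≈-isEquivalence (qb-sum (U-count m) (qb-id Split≈-isEquivalence)) T-step)

theorem4p7 : (m : ℕ) →
    QuotBij (UK≈ {suc m}) (Union≈ {m}) × QuotBij (U≈ {suc m}) (T≈ {m})
theorem4p7 m =
  qb-comp Union≈-isEquivalence UK-decomposition (qb-relabel Union≈-isEquivalence ≈∪⇒Union≈ Union≈⇒≈∪) ,
  U-count m
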